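{- Let $m\geqslant1$. Then for every positive integer $n$, $$\mathcal{F}_m(n)=\prod_{p^\alpha\,\|\,n}\left(f_{m-1}(\alpha)-f_{m-1}(\alpha-1)\right),$$ where the product is over prime powers exactly dividing $n$. Moreover $|\mathcal{F}_m(n)|\leqslant1$. If $\mathcal{F}_m(n)\neq0$, then every prime dividing $n$ occurs in the canonical factorization of $n$ with exponent at least $2\uparrow\uparrow m$.
   Context: For a positive integer $n$ the height $H(n)$ is defined recursively. Set $H(1)=0$. If $n>1$ has canonical factorization $n=p_1^{a_1}\cdots p_k^{a_k}$ (distinct primes, $a_i\geqslant1$), set $H(n)=1+\max_iH(a_i)$. Tetration: $a\uparrow\uparrow0=1$ and $a\uparrow\uparrow(b+1)=a^{a\uparrow\uparrow b}$. For $m\geqslant0$ and $n\geqslant1$ let $f_m(n)=1$ if $H(n)\leqslant m$ and $f_m(n)=0$ otherwise. By convention $f_m(0)=1$ for all $m\geqslant0$; in particular $f_0(\alpha)=1$ exactly for $\alpha\in\{0,1\}$. For $m\geqslant1$ the function $\mathcal{F}_m$ is defined by $f_m(n)=\sum_{d\mid n}\mathcal{F}_m(d)$ for all $n\geqslant1$. -}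

module Defs where

open import Data.Nat using (ℕ; zero; suc; _+_; _∸_; _^_; _≤_; _≤?_; _⊔_)
open import Data.Nat.Divisibility using (_∣_; _∣?_)
open import Data.Nat.Primality using (Prime; prime?)
open import Data.Integer using (ℤ) renaming (_+_ to _+ℤ_; _-_ to _-ℤ_; _*_ to _*ℤ_)
import Data.Integer as ℤ
open import Data.List using (List; map; filter; foldr; upTo; length)
open import Relation.Nullary.Decidable using (_×-dec_; yes; no)
open import Relation.Nullary using (¬_)
open import Data.Product using (_×_)
open import Relation.Binary.PropositionalEquality using (_≡_)

range1 : ℕ → List ℕ
range1 n = map suc (upTo n)

-- p-adic valuation for n ≥ 1, p ≥ 2: number of a ∈ [1..n] with p^a ∣ n.
-- (Since p^a ∣ n is downward closed in a and v_p(n) < n, this is v_p(n).)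
val : ℕ → ℕ → ℕ
val p n = length (filter (λ a → (p ^ a) ∣? n) (range1 n))

primeDivisors : ℕ → List ℕ
primeDivisors n = filter (λ p → prime? p ×-dec p ∣? n) (range1 n)

divisors : ℕ → List ℕ
divisors n = filter (λ d → d ∣? n) (range1 n)

maxList : List ℕ → ℕ
maxList = foldr _⊔_ 0

-- Height with fuel: H(1) = 0, H(n) = 1 + max_{p | n} H(v_p(n)) for n > 1.
-- Fuel n suffices since v_p(n) < n for every exponent that occurs.
Hf : ℕ → ℕ → ℕ
Hf zero n = 0
Hf (suc k) zero = 0
Hf (suc k) (suc zero) = 0
Hf (suc k) n@(suc (suc _)) = suc (maxList (map (λ p → Hf k (val p n)) (primeDivisors n)))

H : ℕ → ℕ
H n = Hf n n

-- f_m(n) = 1 if H(n) ≤ m, else 0;  f_m(0) = 1 by convention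
f : ℕ → ℕ → ℤ
f m zero = ℤ.1ℤ
f m n@(suc _) with H n ≤? m
... | yes _ = ℤ.1ℤ
... | no _ = ℤ.0ℤ

sumℤ : List ℤ → ℤ
sumℤ = foldr _+ℤ_ ℤ.0ℤ

prodℤ : List ℤ → ℤ
prodℤ = foldr _*ℤ_ ℤ.1ℤ

IsDivisorInverse : ℕ → (ℕ → ℤ) → Set
IsDivisorInverse m F = ∀ n → 1 ≤ n → f m n ≡ sumℤ (map F (divisors n))

ExactlyDivides : ℕ → ℕ → ℕ → Set
ExactlyDivides p α n = (p ^ α) ∣ n × ¬ ((p ^ suc α) ∣ n)

_↑↑_ : ℕ → ℕ → ℕ
a ↑↑ zero = 1
a ↑↑ suc b = a ^ (a ↑↑ b)

-- For φ with φ(0) = 1 write Δφ(α) = φ(α) − φ(α − 1). The divisor sum of n ↦ ∏_{p^α ∥ n} Δφ(α)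
-- is multiplicative and at p^α equals Σ_{β ≤ α} Δφ(β) = φ(α), so it is n ↦ ∏_{p^α ∥ n} φ(α).
-- Since H(n) ≤ m + 1 exactly when every exponent of n has height ≤ m, f_{m+1}(n) = ∏ f_m(α), and
-- uniqueness of the divisor-sum inverse gives F_{m+1}(n) = ∏ (f_m(α) − f_m(α − 1)). Each factor
-- lies in {−1, 0, 1}, and it is non-zero only if α or α − 1 has height > m; as a number of height
-- ≥ k + 1 is at least 2 ^ e for an exponent e of height ≥ k, heights force 2↑↑(m + 1) ≤ α.
{-# OPTIONS --safe #-}
module Submission where

open import Defs
open import Data.Nat using (ℕ; NonZero; zero; suc; _+_; _*_; _∸_; _^_; _≤_; _<_; _⊓_; _≤?_; z≤n; s≤s; nonTrivial⇒n>1; >-nonZero)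
open import Data.Nat.Properties
open import Data.Nat.Divisibility
open import Data.Nat.Coprimality using (Coprime; coprime-divisor)
open import Data.Nat.Induction using (<-rec)
open import Data.Nat.Primality
open import Data.Nat.Primality.Factorisation using (factorise)
open import Algebra.Properties.CommutativeSemigroup *-commutativeSemigroup using (x∙yz≈y∙xz)
open import Data.Integer using (ℤ; ∣_∣; _-_; -_; 0ℤ; 1ℤ) renaming (_+_ to _+ℤ_; _*_ to _*ℤ_)
import Data.Integer.Properties as ℤₚ
open import Data.Integer.Tactic.RingSolver using (solve-∀)
open import Data.List using ([]; _∷_; _++_; [_]; map; filter; length; upTo)
open import Data.List.Properties using (map-++; filter-++; length-++; upTo-∷ʳ; map-cong-local; map-∘; filter-accept)
open import Data.List.Membership.Propositional using (_∈_; find)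
open import Data.List.Membership.Propositional.Properties
  using (∈-map⁺; ∈-map⁻; ∈-upTo⁺; ∈-upTo⁻; ∈-filter⁺; ∈-filter⁻; ∈-++⁺ˡ; ∈-++⁺ʳ; ∈-++⁻)
open import Data.List.Membership.Propositional.Properties.WithK using (unique∧set⇒bag)
open import Data.List.Relation.Unary.All as All using (All; []; _∷_)
open import Data.List.Relation.Unary.Any using (Any; here; there)
import Data.List.Relation.Unary.Any.Properties as Any
import Data.List.Relation.Unary.All.Properties as All
open import Data.List.Relation.Unary.AllPairs using (_∷_)
open import Data.List.Relation.Unary.Unique.Propositional using (Unique)
import Data.List.Relation.Unary.Unique.Propositional.Properties as Unique
open import Data.List.Relation.Binary.BagAndSetEquality using (∼bag⇒↭)
open import Data.List.Relation.Binary.Permutation.Propositional using (_↭_; ↭⇒↭ₛ)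
open import Data.List.Relation.Binary.Permutation.Propositional.Properties using (map⁺)
open import Data.List.Relation.Binary.Permutation.Setoid.Properties using (foldr-commMonoid)
open import Data.Product using (_×_; _,_; proj₁; proj₂; ∃; ∃₂)
open import Data.Sum using (_⊎_; inj₁; inj₂)
open import Function using (_∘_; flip)
open import Function.Bundles using (mk⇔)
open import Relation.Nullary using (¬_; yes; no; contradiction)
open import Relation.Nullary.Decidable using (_×-dec_)
open import Relation.Unary using (Decidable)
open import Relation.Binary.PropositionalEquality hiding ([_])

private
  variable
    a k m n p q v α : ℕ

prime⇒1<p : Prime p → 1 < p
prime⇒1<p {p} pp = nonTrivial⇒n>1 p {{prime⇒nonTrivial pp}}

prime⇒p^a≢0 : Prime p → ∀ a → NonZero (p ^ a)
prime⇒p^a≢0 {p} pp a = m^n≢0 p a {{prime⇒nonZero pp}}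

n<m^n : ∀ {m} → 1 < m → ∀ n → n < m ^ n
n<m^n 1<m zero = s≤s z≤n
n<m^n {m} 1<m (suc n) = ≤-<-trans (n<m^n 1<m n) (^-monoʳ-< m 1<m (n<1+n n))

^-monoʳ-∣ : ∀ p {a b} → a ≤ b → p ^ a ∣ p ^ b
^-monoʳ-∣ p {b = b} z≤n = 1∣ (p ^ b)
^-monoʳ-∣ p (s≤s a≤b) = *-monoʳ-∣ p (^-monoʳ-∣ p a≤b)

∣⇒0< : 0 < n → k ∣ n → 0 < k
∣⇒0< {k = zero} 0<n k∣n = contradiction (0∣⇒≡0 k∣n) (m<n⇒n≢0 0<n)
∣⇒0< {k = suc _} _ _ = s≤s z≤n

∤⇒0< : p ∤ k → 0 < k
∤⇒0< {k = zero} p∤0 = contradiction (_ ∣0) p∤0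
∤⇒0< {k = suc _} _ = s≤s z≤n

k<p^a*k : Prime p → 0 < a → 0 < k → k < p ^ a * k
k<p^a*k {p} {a} {k} pp 0<a 0<k = subst (k <_) (*-comm k (p ^ a))
  (m<m*n k (p ^ a) {{>-nonZero 0<k}} (^-monoʳ-< p (prime⇒1<p pp) 0<a))

0<p^a*k : ∀ a → Prime p → p ∤ k → 0 < p ^ a * k
0<p^a*k {p} {k} a pp p∤k = ≤-trans (∤⇒0< p∤k) (m≤n*m k (p ^ a) {{prime⇒p^a≢0 pp a}})

prime∤⇒coprime : Prime p → p ∤ k → Coprime k p
prime∤⇒coprime pp p∤k (d∣k , d∣p) with prime⇒irreducible pp d∣p
... | inj₁ d≡1 = d≡1
... | inj₂ refl = contradiction d∣k p∤k

∣p^a*k⇒∣k : ∀ a {d} → Prime p → p ∤ d → d ∣ p ^ a * k → d ∣ k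
∣p^a*k⇒∣k {k = k} zero pp p∤d d∣k = subst (_ ∣_) (+-identityʳ k) d∣k
∣p^a*k⇒∣k {p} {k} (suc a) {d} pp p∤d d∣ =
  ∣p^a*k⇒∣k a pp p∤d (coprime-divisor (prime∤⇒coprime pp p∤d) (subst (d ∣_) (*-assoc p (p ^ a) k) d∣))

prime∣p^a⇒≡ : ∀ a → Prime p → Prime q → q ∣ p ^ a → q ≡ p
prime∣p^a⇒≡ zero pp pq q∣1 = contradiction (∣1⇒≡1 q∣1) (>⇒≢ (prime⇒1<p pq))
prime∣p^a⇒≡ {p} (suc a) pp pq q∣p^[1+a] with euclidsLemma p (p ^ a) pq q∣p^[1+a]
... | inj₂ q∣p^a = prime∣p^a⇒≡ a pp pq q∣p^a
... | inj₁ q∣p with prime⇒irreducible pp q∣p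
...   | inj₁ q≡1 = contradiction q≡1 (>⇒≢ (prime⇒1<p pq))
...   | inj₂ q≡p = q≡p

p^a∣p^v*k⇒a≤v : Prime p → p ∤ k → p ^ a ∣ p ^ v * k → a ≤ v
p^a∣p^v*k⇒a≤v {p} {k} {a} {v} pp p∤k p^a∣ = ≮⇒≥ λ v<a → p∤k (*-cancelˡ-∣ (p ^ v) {{prime⇒p^a≢0 pp v}}
  (subst (_∣ p ^ v * k) (*-comm p (p ^ v)) (∣-trans (^-monoʳ-∣ p v<a) p^a∣)))

∃primeDivisor : ∀ n → 1 < n → ∃ λ p → Prime p × p ∣ n
∃primeDivisor 1 (s≤s ())
∃primeDivisor n@(suc (suc _)) _ with factorise n
... | record { factors = [] ; isFactorisation = () }
... | record { factors = p ∷ _ ; isFactorisation = n≡ ; factorsPrime = pp ∷ _ } =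
  p , pp , subst (p ∣_) (sym n≡) (m∣m*n _)

-- p-adic valuation

Decomposition : ℕ → ℕ → Set
Decomposition p n = ∃₂ λ v k → n ≡ p ^ v * k × p ∤ k

decompose : Prime p → ∀ n → 0 < n → Decomposition p n
decompose {p} pp = <-rec (λ n → 0 < n → Decomposition p n) split
  where
  split : ∀ n → (∀ {m} → m < n → 0 < m → Decomposition p m) → 0 < n → Decomposition p n
  split n rec 0<n with p ∣? n
  ... | no p∤n = 0 , n , sym (+-identityʳ n) , p∤n
  ... | yes (divides zero n≡0) = contradiction n≡0 (m<n⇒n≢0 0<n)
  ... | yes (divides q@(suc _) n≡q*p)
    with v , k , q≡p^v*k , p∤k ← rec (subst (q <_) (sym n≡q*p) (m<m*n q p (prime⇒1<p pp))) (s≤s z≤n)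
    = suc v , k , n≡p^[1+v]*k , p∤k
    where
    open ≡-Reasoning
    n≡p^[1+v]*k : n ≡ p ^ suc v * k
    n≡p^[1+v]*k = begin
      n                ≡⟨ n≡q*p ⟩
      q * p            ≡⟨ *-comm q p ⟩
      p * q            ≡⟨ cong (p *_) q≡p^v*k ⟩
      p * (p ^ v * k)  ≡⟨ *-assoc p (p ^ v) k ⟨
      p ^ suc v * k    ∎

range1-∷ʳ : ∀ n → range1 (suc n) ≡ range1 n ++ [ suc n ]
range1-∷ʳ n = trans (cong (map suc) (sym (upTo-∷ʳ n))) (map-++ suc (upTo n) [ n ])

length-filter-range1 : ∀ {P : ℕ → Set} (P? : Decidable P) →
  (∀ {a} → 0 < a → P a → a ≤ v) → (∀ {a} → 0 < a → a ≤ v → P a) →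
  ∀ n → length (filter P? (range1 n)) ≡ n ⊓ v
length-filter-range1 P? sound complete zero = refl
length-filter-range1 {v} P? sound complete (suc n) = begin
  length (filter P? (range1 (suc n)))                           ≡⟨ cong (length ∘ filter P?) (range1-∷ʳ n) ⟩
  length (filter P? (range1 n ++ [ suc n ]))                    ≡⟨ cong length (filter-++ P? (range1 n) [ suc n ]) ⟩
  length (filter P? (range1 n) ++ filter P? [ suc n ])          ≡⟨ length-++ (filter P? (range1 n)) ⟩
  length (filter P? (range1 n)) + length (filter P? [ suc n ])  ≡⟨ cong (_+ _) (length-filter-range1 P? sound complete n) ⟩
  n ⊓ v + length (filter P? [ suc n ])                          ≡⟨ last-step ⟩
  suc n ⊓ v                                                     ∎
  where
  open ≡-Reasoning
  last-step : n ⊓ v + length (filter P? [ suc n ]) ≡ suc n ⊓ v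
  last-step with P? (suc n)
  ... | yes P[1+n] = trans (cong (_+ 1) (m≤n⇒m⊓n≡m (<⇒≤ n<v))) (trans (+-comm n 1) (sym (m≤n⇒m⊓n≡m n<v)))
    where n<v = sound (s≤s z≤n) P[1+n]
  ... | no ¬P[1+n] = trans (+-identityʳ _) (trans (m≥n⇒m⊓n≡n v≤n) (sym (m≥n⇒m⊓n≡n (m≤n⇒m≤1+n v≤n))))
    where v≤n = ≮⇒≥ (¬P[1+n] ∘ complete (s≤s z≤n))

val-p^v*k : Prime p → n ≡ p ^ v * k → p ∤ k → val p n ≡ v
val-p^v*k {p} {n} {v} {k} pp n≡p^v*k p∤k =
  trans (length-filter-range1 (λ a → p ^ a ∣? n) sound complete n) (m≥n⇒m⊓n≡n v≤n)
  where
  sound : ∀ {a} → 0 < a → p ^ a ∣ n → a ≤ v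
  sound {a} _ p^a∣n = p^a∣p^v*k⇒a≤v pp p∤k (subst (p ^ a ∣_) n≡p^v*k p^a∣n)
  complete : ∀ {a} → 0 < a → a ≤ v → p ^ a ∣ n
  complete {a} _ a≤v = subst (p ^ a ∣_) (sym n≡p^v*k) (∣-trans (^-monoʳ-∣ p a≤v) (m∣m*n k))
  v≤n : v ≤ n
  v≤n = <⇒≤ (<-≤-trans (n<m^n (prime⇒1<p pp) v)
          (subst (p ^ v ≤_) (sym n≡p^v*k) (m≤m*n (p ^ v) k {{>-nonZero (∤⇒0< p∤k)}})))

decompose-val : Prime p → 0 < n → ∃ λ k → n ≡ p ^ val p n * k × p ∤ k
decompose-val {n = n} pp 0<n with v , k , n≡p^v*k , p∤k ← decompose pp n 0<n
  rewrite val-p^v*k {v = v} pp n≡p^v*k p∤k = k , n≡p^v*k , p∤k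

p^val∣n : Prime p → 0 < n → p ^ val p n ∣ n
p^val∣n {p} {n} pp 0<n with k , n≡ , _ ← decompose-val pp 0<n = subst (p ^ val p n ∣_) (sym n≡) (m∣m*n k)

p^val≤n : Prime p → 0 < n → p ^ val p n ≤ n
p^val≤n {p} {n} pp 0<n with k , n≡ , p∤k ← decompose-val pp 0<n =
  subst (p ^ val p n ≤_) (sym n≡) (m≤m*n (p ^ val p n) k {{>-nonZero (∤⇒0< p∤k)}})

val<n : Prime p → 0 < n → val p n < n
val<n pp 0<n = <-≤-trans (n<m^n (prime⇒1<p pp) _) (p^val≤n pp 0<n)

p^a∣n⇒a≤val : Prime p → 0 < n → p ^ a ∣ n → a ≤ val p n
p^a∣n⇒a≤val {p} {n} {a} pp 0<n p^a∣n with k , n≡ , p∤k ← decompose-val pp 0<n =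
  p^a∣p^v*k⇒a≤v pp p∤k (subst (p ^ a ∣_) n≡ p^a∣n)

∣⇒0<val : Prime p → 0 < n → p ∣ n → 0 < val p n
∣⇒0<val {p} {n} pp 0<n p∣n = p^a∣n⇒a≤val pp 0<n (subst (_∣ n) (sym (*-identityʳ p)) p∣n)

exactlyDivides⇒≡val : Prime p → 0 < n → ExactlyDivides p α n → α ≡ val p n
exactlyDivides⇒≡val {p} pp 0<n (p^α∣n , p^[1+α]∤n) = ≤-antisym (p^a∣n⇒a≤val pp 0<n p^α∣n)
  (≮⇒≥ λ α<val → p^[1+α]∤n (∣-trans (^-monoʳ-∣ p α<val) (p^val∣n pp 0<n)))

val-p^a*k≡val-k : ∀ a → Prime p → Prime q → q ≢ p → 0 < k → val q (p ^ a * k) ≡ val q k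
val-p^a*k≡val-k {p} {q} {k} a pp pq q≢p 0<k with k′ , k≡ , q∤k′ ← decompose-val pq 0<k =
  val-p^v*k pq p^a*k≡ q∤p^a*k′
  where
  p^a*k≡ : p ^ a * k ≡ q ^ val q k * (p ^ a * k′)
  p^a*k≡ = trans (cong (p ^ a *_) k≡) (x∙yz≈y∙xz (p ^ a) (q ^ val q k) k′)
  q∤p^a*k′ : q ∤ p ^ a * k′
  q∤p^a*k′ q∣ with euclidsLemma (p ^ a) k′ pq q∣
  ... | inj₁ q∣p^a = q≢p (prime∣p^a⇒≡ a pp pq q∣p^a)
  ... | inj₂ q∣k′ = q∤k′ q∣k′


∈-range1⁻ : q ∈ range1 n → 0 < q × q ≤ n
∈-range1⁻ q∈ with r , r∈ , refl ← ∈-map⁻ suc q∈ = s≤s z≤n , ∈-upTo⁻ r∈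

∈-range1⁺ : 0 < q → q ≤ n → q ∈ range1 n
∈-range1⁺ {suc _} _ q≤n = ∈-map⁺ suc (∈-upTo⁺ q≤n)

range1-unique : ∀ n → Unique (range1 n)
range1-unique n = Unique.map⁺ suc-injective (Unique.upTo⁺ n)

∈-divisors⁻ : q ∈ divisors n → q ∣ n
∈-divisors⁻ {n = n} q∈ = proj₂ (∈-filter⁻ (_∣? n) {xs = range1 n} q∈)

∈-divisors⁺ : 0 < n → q ∣ n → q ∈ divisors n
∈-divisors⁺ {n} 0<n q∣n = ∈-filter⁺ (_∣? n) (∈-range1⁺ (∣⇒0< 0<n q∣n) (∣⇒≤ {{>-nonZero 0<n}} q∣n)) q∣n

divisors-unique : ∀ n → Unique (divisors n)
divisors-unique n = Unique.filter⁺ (_∣? n) (range1-unique n)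

∈-primeDivisors⁻ : q ∈ primeDivisors n → Prime q × q ∣ n
∈-primeDivisors⁻ {n = n} q∈ = proj₂ (∈-filter⁻ (λ r → prime? r ×-dec r ∣? n) {xs = range1 n} q∈)

∈-primeDivisors⁺ : 0 < n → Prime q → q ∣ n → q ∈ primeDivisors n
∈-primeDivisors⁺ {n} 0<n pq q∣n =
  ∈-filter⁺ (λ r → prime? r ×-dec r ∣? n) (∈-range1⁺ (∣⇒0< 0<n q∣n) (∣⇒≤ {{>-nonZero 0<n}} q∣n)) (pq , q∣n)

primeDivisors-unique : ∀ n → Unique (primeDivisors n)
primeDivisors-unique n = Unique.filter⁺ (λ r → prime? r ×-dec r ∣? n) (range1-unique n)

∈-primeDivisors⇒0<val : 0 < n → q ∈ primeDivisors n → 0 < val q n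
∈-primeDivisors⇒0<val 0<n q∈ with pq , q∣n ← ∈-primeDivisors⁻ q∈ = ∣⇒0<val pq 0<n q∣n


x+[y-x]≡y : ∀ x y → x +ℤ (y - x) ≡ y
x+[y-x]≡y = solve-∀

+ℤ-cancelˡ : ∀ i {j k} → i +ℤ j ≡ i +ℤ k → j ≡ k
+ℤ-cancelˡ i {j} {k} i+j≡i+k = begin
  j              ≡⟨ -i+[i+j]≡j i j ⟨
  - i +ℤ (i +ℤ j) ≡⟨ cong (- i +ℤ_) i+j≡i+k ⟩
  - i +ℤ (i +ℤ k) ≡⟨ -i+[i+j]≡j i k ⟩
  k              ∎
  where
  open ≡-Reasoning
  -i+[i+j]≡j : ∀ i j → - i +ℤ (i +ℤ j) ≡ j
  -i+[i+j]≡j = solve-∀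

sumℤ-↭ : ∀ {xs ys} → xs ↭ ys → sumℤ xs ≡ sumℤ ys
sumℤ-↭ xs↭ys = foldr-commMonoid (setoid ℤ) ℤₚ.+-0-isCommutativeMonoid (↭⇒↭ₛ xs↭ys)

prodℤ-↭ : ∀ {xs ys} → xs ↭ ys → prodℤ xs ≡ prodℤ ys
prodℤ-↭ xs↭ys = foldr-commMonoid (setoid ℤ) ℤₚ.*-1-isCommutativeMonoid (↭⇒↭ₛ xs↭ys)

sumℤ-++ : ∀ xs ys → sumℤ (xs ++ ys) ≡ sumℤ xs +ℤ sumℤ ys
sumℤ-++ [] ys = sym (ℤₚ.+-identityˡ (sumℤ ys))
sumℤ-++ (x ∷ xs) ys = trans (cong (x +ℤ_) (sumℤ-++ xs ys)) (sym (ℤₚ.+-assoc x (sumℤ xs) (sumℤ ys)))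

sumℤ-*ˡ : ∀ c zs → sumℤ (map (c *ℤ_) zs) ≡ c *ℤ sumℤ zs
sumℤ-*ˡ c [] = sym (ℤₚ.*-zeroʳ c)
sumℤ-*ˡ c (z ∷ zs) = trans (cong (c *ℤ z +ℤ_) (sumℤ-*ˡ c zs)) (sym (ℤₚ.*-distribˡ-+ c z (sumℤ zs)))

prodℤ-map-≡1 : ∀ {h : ℕ → ℤ} xs → (∀ {x} → x ∈ xs → h x ≡ 1ℤ) → prodℤ (map h xs) ≡ 1ℤ
prodℤ-map-≡1 [] _ = refl
prodℤ-map-≡1 {h} (x ∷ xs) h≡1 = begin
  h x *ℤ prodℤ (map h xs)  ≡⟨ cong₂ _*ℤ_ (h≡1 (here refl)) (prodℤ-map-≡1 xs (h≡1 ∘ there)) ⟩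
  1ℤ *ℤ 1ℤ                 ≡⟨⟩
  1ℤ                       ∎
  where open ≡-Reasoning

prodℤ-map-≡0 : ∀ {h : ℕ → ℤ} {x xs} → x ∈ xs → h x ≡ 0ℤ → prodℤ (map h xs) ≡ 0ℤ
prodℤ-map-≡0 {h} {xs = _ ∷ xs} (here refl) h[x]≡0 = trans (cong (_*ℤ prodℤ (map h xs)) h[x]≡0) (ℤₚ.*-zeroˡ (prodℤ (map h xs)))
prodℤ-map-≡0 {h} {xs = y ∷ _} (there x∈) h[x]≡0 = trans (cong (h y *ℤ_) (prodℤ-map-≡0 {h} x∈ h[x]≡0)) (ℤₚ.*-zeroʳ (h y))

∣prodℤ-map∣≤1 : ∀ {h : ℕ → ℤ} xs → (∀ x → ∣ h x ∣ ≤ 1) → ∣ prodℤ (map h xs) ∣ ≤ 1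
∣prodℤ-map∣≤1 [] _ = ≤-refl
∣prodℤ-map∣≤1 {h} (x ∷ xs) ∣h∣≤1 = begin
  ∣ h x *ℤ prodℤ (map h xs) ∣      ≡⟨ ℤₚ.abs-* (h x) (prodℤ (map h xs)) ⟩
  ∣ h x ∣ * ∣ prodℤ (map h xs) ∣   ≤⟨ *-mono-≤ (∣h∣≤1 x) (∣prodℤ-map∣≤1 xs ∣h∣≤1) ⟩
  1                                ∎
  where open ≤-Reasoning

-- Divisor sums

divisorSum : (ℕ → ℤ) → ℕ → ℤ
divisorSum h n = sumℤ (map h (divisors n))

∣p^[1+a]*k⇒ : ∀ a {d} → Prime p → p ∤ k → d ∣ p ^ suc a * k →
  d ∣ p ^ a * k ⊎ ∃ λ e → d ≡ p ^ suc a * e × e ∣ k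
∣p^[1+a]*k⇒ {p} {k} a {d} pp p∤k d∣ with p ^ suc a ∣? d
... | yes (divides e d≡e*p^[1+a]) =
  inj₂ (e , d≡ , *-cancelˡ-∣ (p ^ suc a) {{prime⇒p^a≢0 pp (suc a)}} (subst (_∣ p ^ suc a * k) d≡ d∣))
  where d≡ = trans d≡e*p^[1+a] (*-comm e (p ^ suc a))
... | no p^[1+a]∤d with d′ , d≡ , p∤d′ ← decompose-val pp (∣⇒0< (0<p^a*k (suc a) pp p∤k) d∣) =
  inj₁ (subst (_∣ p ^ a * k) (sym d≡) (*-pres-∣ (^-monoʳ-∣ p val≤a) d′∣k))
  where
  val≤a : val p d ≤ a
  val≤a = ≮⇒≥ λ a<val → p^[1+a]∤d (∣-trans (^-monoʳ-∣ p a<val) (subst (p ^ val p d ∣_) (sym d≡) (m∣m*n d′)))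
  d′∣k : d′ ∣ k
  d′∣k = ∣p^a*k⇒∣k (suc a) pp p∤d′ (∣-trans (subst (d′ ∣_) (sym d≡) (n∣m*n (p ^ val p d))) d∣)

divisors-p^[1+a]*k : ∀ a → Prime p → p ∤ k →
  divisors (p ^ suc a * k) ↭ divisors (p ^ a * k) ++ map (p ^ suc a *_) (divisors k)
divisors-p^[1+a]*k {p} {k} a pp p∤k =
  ∼bag⇒↭ (unique∧set⇒bag (divisors-unique (p ^ suc a * k)) unique (mk⇔ to from))
  where
  lower = divisors (p ^ a * k)
  upper = map (p ^ suc a *_) (divisors k)
  to : ∀ {d} → d ∈ divisors (p ^ suc a * k) → d ∈ lower ++ upper
  to d∈ with ∣p^[1+a]*k⇒ a pp p∤k (∈-divisors⁻ d∈)
  ... | inj₁ d∣ = ∈-++⁺ˡ (∈-divisors⁺ (0<p^a*k a pp p∤k) d∣)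
  ... | inj₂ (e , refl , e∣k) = ∈-++⁺ʳ lower (∈-map⁺ (p ^ suc a *_) (∈-divisors⁺ (∤⇒0< p∤k) e∣k))
  from : ∀ {d} → d ∈ lower ++ upper → d ∈ divisors (p ^ suc a * k)
  from d∈ with ∈-++⁻ lower d∈
  ... | inj₁ d∈lower = ∈-divisors⁺ (0<p^a*k (suc a) pp p∤k)
    (∣-trans (∈-divisors⁻ d∈lower) (subst (p ^ a * k ∣_) (sym (*-assoc p (p ^ a) k)) (n∣m*n p)))
  ... | inj₂ d∈upper with e , e∈ , refl ← ∈-map⁻ (p ^ suc a *_) d∈upper =
    ∈-divisors⁺ (0<p^a*k (suc a) pp p∤k) (*-monoʳ-∣ (p ^ suc a) (∈-divisors⁻ e∈))
  disjoint : ∀ {d} → ¬ (d ∈ lower × d ∈ upper)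
  disjoint (d∈lower , d∈upper) with e , _ , refl ← ∈-map⁻ (p ^ suc a *_) d∈upper =
    1+n≰n (p^a∣p^v*k⇒a≤v {v = a} pp p∤k (∣-trans (m∣m*n e) (∈-divisors⁻ {n = p ^ a * k} d∈lower)))
  unique : Unique (lower ++ upper)
  unique = Unique.++⁺ (divisors-unique (p ^ a * k))
    (Unique.map⁺ (*-cancelˡ-≡ _ _ (p ^ suc a) {{prime⇒p^a≢0 pp (suc a)}}) (divisors-unique k)) disjoint

divisorSum-p^[1+a]*k : ∀ h a → Prime p → p ∤ k →
  divisorSum h (p ^ suc a * k) ≡ divisorSum h (p ^ a * k) +ℤ divisorSum (h ∘ (p ^ suc a *_)) k
divisorSum-p^[1+a]*k {p} {k} h a pp p∤k = begin
  divisorSum h (p ^ suc a * k)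
    ≡⟨ sumℤ-↭ (map⁺ h (divisors-p^[1+a]*k a pp p∤k)) ⟩
  sumℤ (map h (lower ++ upper))
    ≡⟨ cong sumℤ (map-++ h lower upper) ⟩
  sumℤ (map h lower ++ map h upper)
    ≡⟨ sumℤ-++ (map h lower) (map h upper) ⟩
  divisorSum h (p ^ a * k) +ℤ sumℤ (map h upper)
    ≡⟨ cong (λ zs → divisorSum h (p ^ a * k) +ℤ sumℤ zs) (map-∘ (divisors k)) ⟨
  divisorSum h (p ^ a * k) +ℤ divisorSum (h ∘ (p ^ suc a *_)) k
    ∎
  where
  open ≡-Reasoning
  lower = divisors (p ^ a * k)
  upper = map (p ^ suc a *_) (divisors k)

divisors-suc : ∀ n → divisors (suc n) ≡ filter (_∣? suc n) (range1 n) ++ [ suc n ]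
divisors-suc n = begin
  filter (_∣? suc n) (range1 (suc n))                           ≡⟨ cong (filter (_∣? suc n)) (range1-∷ʳ n) ⟩
  filter (_∣? suc n) (range1 n ++ [ suc n ])                    ≡⟨ filter-++ (_∣? suc n) (range1 n) [ suc n ] ⟩
  filter (_∣? suc n) (range1 n) ++ filter (_∣? suc n) [ suc n ] ≡⟨ cong (filter (_∣? suc n) (range1 n) ++_) (filter-accept (_∣? suc n) ∣-refl) ⟩
  filter (_∣? suc n) (range1 n) ++ [ suc n ]                    ∎
  where open ≡-Reasoning

divisorSum-injective : ∀ {F G : ℕ → ℤ} → (∀ n → 0 < n → divisorSum F n ≡ divisorSum G n) →
  ∀ n → 0 < n → F n ≡ G n
divisorSum-injective {F} {G} ΣF≡ΣG = <-rec _ go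
  where
  go : ∀ n → (∀ {m} → m < n → 0 < m → F m ≡ G m) → 0 < n → F n ≡ G n
  go (suc n) rec _ = +ℤ-cancelˡ (sumℤ (map F proper)) (begin
    sumℤ (map F proper) +ℤ F (suc n) ≡⟨ split F ⟨
    divisorSum F (suc n)             ≡⟨ ΣF≡ΣG (suc n) (s≤s z≤n) ⟩
    divisorSum G (suc n)             ≡⟨ split G ⟩
    sumℤ (map G proper) +ℤ G (suc n) ≡⟨ cong (λ zs → sumℤ zs +ℤ G (suc n)) (map-cong-local (All.tabulate F≡G-proper)) ⟨
    sumℤ (map F proper) +ℤ G (suc n) ∎)
    where
    open ≡-Reasoning
    proper = filter (_∣? suc n) (range1 n)
    split : ∀ h → divisorSum h (suc n) ≡ sumℤ (map h proper) +ℤ h (suc n)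
    split h = begin
      sumℤ (map h (divisors (suc n)))                 ≡⟨ cong (sumℤ ∘ map h) (divisors-suc n) ⟩
      sumℤ (map h (proper ++ [ suc n ]))              ≡⟨ cong sumℤ (map-++ h proper [ suc n ]) ⟩
      sumℤ (map h proper ++ [ h (suc n) ])            ≡⟨ sumℤ-++ (map h proper) [ h (suc n) ] ⟩
      sumℤ (map h proper) +ℤ (h (suc n) +ℤ 0ℤ)        ≡⟨ cong (sumℤ (map h proper) +ℤ_) (ℤₚ.+-identityʳ (h (suc n))) ⟩
      sumℤ (map h proper) +ℤ h (suc n)                ∎
    F≡G-proper : ∀ {d} → d ∈ proper → F d ≡ G d
    F≡G-proper d∈ with 0<d , d≤n ← ∈-range1⁻ (proj₁ (∈-filter⁻ (_∣? suc n) {xs = range1 n} d∈)) = rec (s≤s d≤n) 0<d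

-- Products over the exponents of the canonical factorization

primeDivisors-p^a*k : ∀ a → Prime p → 0 < a → p ∤ k → primeDivisors (p ^ a * k) ↭ p ∷ primeDivisors k
primeDivisors-p^a*k {p} {k} a pp 0<a p∤k =
  ∼bag⇒↭ (unique∧set⇒bag (primeDivisors-unique (p ^ a * k)) unique (mk⇔ to from))
  where
  to : ∀ {q} → q ∈ primeDivisors (p ^ a * k) → q ∈ p ∷ primeDivisors k
  to q∈ with pq , q∣ ← ∈-primeDivisors⁻ q∈ with euclidsLemma (p ^ a) k pq q∣
  ... | inj₁ q∣p^a = here (prime∣p^a⇒≡ a pp pq q∣p^a)
  ... | inj₂ q∣k = there (∈-primeDivisors⁺ (∤⇒0< p∤k) pq q∣k)
  from : ∀ {q} → q ∈ p ∷ primeDivisors k → q ∈ primeDivisors (p ^ a * k)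
  from (here refl) = ∈-primeDivisors⁺ (0<p^a*k a pp p∤k) pp
    (∣-trans (∣-reflexive (sym (*-identityʳ p))) (∣-trans (^-monoʳ-∣ p 0<a) (m∣m*n k)))
  from (there q∈) with pq , q∣k ← ∈-primeDivisors⁻ q∈ = ∈-primeDivisors⁺ (0<p^a*k a pp p∤k) pq (∣n⇒∣m*n (p ^ a) q∣k)
  unique : Unique (p ∷ primeDivisors k)
  unique = All.tabulate (λ q∈ p≡q → p∤k (subst (_∣ k) (sym p≡q) (proj₂ (∈-primeDivisors⁻ q∈)))) ∷ primeDivisors-unique k

exponentProduct : (ℕ → ℤ) → ℕ → ℤ
exponentProduct φ n = prodℤ (map (λ q → φ (val q n)) (primeDivisors n))

exponentProduct-p^a*k : ∀ φ a → Prime p → 0 < a → p ∤ k →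
  exponentProduct φ (p ^ a * k) ≡ φ a *ℤ exponentProduct φ k
exponentProduct-p^a*k {p} {k} φ a pp 0<a p∤k = begin
  exponentProduct φ (p ^ a * k)                                ≡⟨ prodℤ-↭ (map⁺ φ∘val (primeDivisors-p^a*k a pp 0<a p∤k)) ⟩
  φ (val p (p ^ a * k)) *ℤ prodℤ (map φ∘val (primeDivisors k))  ≡⟨ cong₂ _*ℤ_ (cong φ (val-p^v*k pp refl p∤k))
                                                                            (cong prodℤ (map-cong-local (All.tabulate val-unchanged))) ⟩
  φ a *ℤ exponentProduct φ k                                    ∎
  where
  open ≡-Reasoning
  φ∘val = λ q → φ (val q (p ^ a * k))
  val-unchanged : ∀ {q} → q ∈ primeDivisors k → φ (val q (p ^ a * k)) ≡ φ (val q k)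
  val-unchanged q∈ with pq , q∣k ← ∈-primeDivisors⁻ q∈ =
    cong φ (val-p^a*k≡val-k a pp pq (λ { refl → p∤k q∣k }) (∤⇒0< p∤k))

≡exponentProduct : ∀ {h : ℕ → ℤ} φ → h 1 ≡ 1ℤ →
  (∀ {p a k} → Prime p → 0 < a → p ∤ k → h (p ^ a * k) ≡ φ a *ℤ h k) →
  ∀ n → 0 < n → h n ≡ exponentProduct φ n
≡exponentProduct {h} φ h[1]≡1 h-p^a*k = <-rec _ go
  where
  go : ∀ n → (∀ {m} → m < n → 0 < m → h m ≡ exponentProduct φ m) → 0 < n → h n ≡ exponentProduct φ n
  go (suc zero) _ _ = h[1]≡1
  go n@(suc (suc _)) rec 0<n with p , pp , p∣n ← ∃primeDivisor n (s≤s (s≤s z≤n))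
    with k , n≡ , p∤k ← decompose-val pp 0<n = begin
    h n                                ≡⟨ cong h n≡ ⟩
    h (p ^ ν * k)                      ≡⟨ h-p^a*k pp 0<ν p∤k ⟩
    φ ν *ℤ h k                         ≡⟨ cong (φ ν *ℤ_) (rec k<n (∤⇒0< p∤k)) ⟩
    φ ν *ℤ exponentProduct φ k         ≡⟨ exponentProduct-p^a*k φ ν pp 0<ν p∤k ⟨
    exponentProduct φ (p ^ ν * k)      ≡⟨ cong (exponentProduct φ) n≡ ⟨
    exponentProduct φ n                ∎
    where
    open ≡-Reasoning
    ν = val p n
    0<ν = ∣⇒0<val pp 0<n p∣n
    k<n = subst (k <_) (sym n≡) (k<p^a*k pp 0<ν (∤⇒0< p∤k))

Δ : (ℕ → ℤ) → ℕ → ℤ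
Δ φ α = φ α - φ (α ∸ 1)

divisorSum-exponentProduct-Δ-p^a*k : ∀ φ → φ 0 ≡ 1ℤ → Prime p → p ∤ k → ∀ a →
  divisorSum (exponentProduct (Δ φ)) (p ^ a * k) ≡ φ a *ℤ divisorSum (exponentProduct (Δ φ)) k
divisorSum-exponentProduct-Δ-p^a*k {k = k} φ φ[0]≡1 pp p∤k zero = begin
  S (1 * k)     ≡⟨ cong S (*-identityˡ k) ⟩
  S k           ≡⟨ ℤₚ.*-identityˡ (S k) ⟨
  1ℤ *ℤ S k     ≡⟨ cong (_*ℤ S k) φ[0]≡1 ⟨
  φ 0 *ℤ S k    ∎
  where
  open ≡-Reasoning
  S = divisorSum (exponentProduct (Δ φ))
divisorSum-exponentProduct-Δ-p^a*k {p} {k} φ φ[0]≡1 pp p∤k (suc a) = begin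
  S (p ^ suc a * k)                                        ≡⟨ divisorSum-p^[1+a]*k G a pp p∤k ⟩
  S (p ^ a * k) +ℤ divisorSum (G ∘ (p ^ suc a *_)) k       ≡⟨ cong₂ _+ℤ_ (divisorSum-exponentProduct-Δ-p^a*k φ φ[0]≡1 pp p∤k a) upper ⟩
  φ a *ℤ S k +ℤ Δ φ (suc a) *ℤ S k                         ≡⟨ ℤₚ.*-distribʳ-+ (S k) (φ a) (Δ φ (suc a)) ⟨
  (φ a +ℤ Δ φ (suc a)) *ℤ S k                              ≡⟨ cong (_*ℤ S k) (x+[y-x]≡y (φ a) (φ (suc a))) ⟩
  φ (suc a) *ℤ S k                                         ∎
  where
  open ≡-Reasoning
  G = exponentProduct (Δ φ)
  S = divisorSum G
  G-p^[1+a]*e : ∀ {e} → e ∈ divisors k → G (p ^ suc a * e) ≡ Δ φ (suc a) *ℤ G e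
  G-p^[1+a]*e e∈ = exponentProduct-p^a*k (Δ φ) (suc a) pp (s≤s z≤n) (p∤k ∘ flip ∣-trans (∈-divisors⁻ e∈))
  upper : divisorSum (G ∘ (p ^ suc a *_)) k ≡ Δ φ (suc a) *ℤ S k
  upper = begin
    sumℤ (map (G ∘ (p ^ suc a *_)) (divisors k))          ≡⟨ cong sumℤ (map-cong-local (All.tabulate G-p^[1+a]*e)) ⟩
    sumℤ (map ((Δ φ (suc a) *ℤ_) ∘ G) (divisors k))       ≡⟨ cong sumℤ (map-∘ (divisors k)) ⟩
    sumℤ (map (Δ φ (suc a) *ℤ_) (map G (divisors k)))     ≡⟨ sumℤ-*ˡ (Δ φ (suc a)) (map G (divisors k)) ⟩
    Δ φ (suc a) *ℤ S k                                    ∎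

divisorSum-exponentProduct-Δ : ∀ φ → φ 0 ≡ 1ℤ → ∀ n → 0 < n →
  divisorSum (exponentProduct (Δ φ)) n ≡ exponentProduct φ n
divisorSum-exponentProduct-Δ φ φ[0]≡1 =
  ≡exponentProduct φ refl (λ pp _ p∤k → divisorSum-exponentProduct-Δ-p^a*k φ φ[0]≡1 pp p∤k _)

-- Height

maxList≤⇒All≤ : ∀ {b} xs → maxList xs ≤ b → All (_≤ b) xs
maxList≤⇒All≤ [] _ = []
maxList≤⇒All≤ (x ∷ xs) x⊔M≤b = ≤-trans (m≤m⊔n x _) x⊔M≤b ∷ maxList≤⇒All≤ xs (≤-trans (m≤n⊔m x _) x⊔M≤b)

<maxList⇒Any< : ∀ {b} xs → b < maxList xs → Any (b <_) xs
<maxList⇒Any< (x ∷ xs) b<x⊔M with ⊔-sel x (maxList xs)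
... | inj₁ x⊔M≡x = here (subst (_ <_) x⊔M≡x b<x⊔M)
... | inj₂ x⊔M≡M = there (<maxList⇒Any< xs (subst (_ <_) x⊔M≡M b<x⊔M))

-- H n = Hf n n, but unfolding it hands fuel n ∸ 1 to the exponents, hence fuel irrelevance.
Hf-fuel : ∀ k k′ {n} → n ≤ k → n ≤ k′ → Hf k n ≡ Hf k′ n
Hf-fuel zero zero _ _ = refl
Hf-fuel zero (suc _) z≤n _ = refl
Hf-fuel (suc _) zero _ z≤n = refl
Hf-fuel (suc _) (suc _) {zero} _ _ = refl
Hf-fuel (suc _) (suc _) {1} _ _ = refl
Hf-fuel (suc k) (suc k′) {n@(suc (suc _))} n≤1+k n≤1+k′ =
  cong (suc ∘ maxList) (map-cong-local (All.tabulate λ q∈ →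
    let val<n′ = val<n (proj₁ (∈-primeDivisors⁻ {n = n} q∈)) (s≤s z≤n) in
    Hf-fuel k k′ (m<1+n⇒m≤n (<-≤-trans val<n′ n≤1+k)) (m<1+n⇒m≤n (<-≤-trans val<n′ n≤1+k′))))

H-unfold : ∀ n → 1 < n → H n ≡ suc (maxList (map (λ q → H (val q n)) (primeDivisors n)))
H-unfold 1 (s≤s ())
H-unfold n@(suc (suc n-2)) _ = cong (suc ∘ maxList) (map-cong-local (All.tabulate λ q∈ →
  Hf-fuel (suc n-2) _ (m<1+n⇒m≤n (val<n (proj₁ (∈-primeDivisors⁻ {n = n} q∈)) (s≤s z≤n))) ≤-refl))

H≤1+m⇒All[H∘val≤m] : 1 < n → H n ≤ suc m → All (λ q → H (val q n) ≤ m) (primeDivisors n)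
H≤1+m⇒All[H∘val≤m] {n} {m} 1<n H≤1+m =
  All.map⁻ (maxList≤⇒All≤ _ (≤-pred (subst (_≤ suc m) (H-unfold n 1<n) H≤1+m)))

1+m<H⇒Any[m<H∘val] : 1 < n → suc m < H n → Any (λ q → m < H (val q n)) (primeDivisors n)
1+m<H⇒Any[m<H∘val] {n} {m} 1<n 1+m<H =
  Any.map⁻ (<maxList⇒Any< _ (≤-pred (subst (suc m <_) (H-unfold n 1<n) 1+m<H)))

f≡1 : 0 < n → H n ≤ m → f m n ≡ 1ℤ
f≡1 {suc n} {m} _ H≤m with H (suc n) ≤? m
... | yes _ = refl
... | no H≰m = contradiction H≤m H≰m

f≡0 : 0 < n → m < H n → f m n ≡ 0ℤ
f≡0 {suc n} {m} _ m<H with H (suc n) ≤? m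
... | yes H≤m = contradiction H≤m (<⇒≱ m<H)
... | no _ = refl

f∈01 : ∀ m n → f m n ≡ 0ℤ ⊎ f m n ≡ 1ℤ
f∈01 m zero = inj₂ refl
f∈01 m (suc n) with H (suc n) ≤? m
... | yes _ = inj₂ refl
... | no _ = inj₁ refl

f-suc : 0 < n → f (suc m) n ≡ exponentProduct (f m) n
f-suc {1} _ = refl
f-suc {n@(suc (suc _))} {m} 0<n with ≤-<-connex (H n) (suc m)
... | inj₁ H≤1+m = trans (f≡1 0<n H≤1+m) (sym (prodℤ-map-≡1 (primeDivisors n) λ q∈ →
  f≡1 (∈-primeDivisors⇒0<val 0<n q∈) (All.lookup (H≤1+m⇒All[H∘val≤m] {n} (s≤s (s≤s z≤n)) H≤1+m) q∈)))
... | inj₂ 1+m<H =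
  let q , q∈ , m<H[val] = find (1+m<H⇒Any[m<H∘val] {n} (s≤s (s≤s z≤n)) 1+m<H)
  in trans (f≡0 0<n 1+m<H) (sym (prodℤ-map-≡0 q∈ (f≡0 (∈-primeDivisors⇒0<val 0<n q∈) m<H[val])))

2↑↑m≤n : ∀ m n → 0 < n → m ≤ H n → 2 ↑↑ m ≤ n
2↑↑m≤n zero n 0<n _ = 0<n
2↑↑m≤n (suc _) 1 _ ()
2↑↑m≤n 1 (suc (suc _)) _ _ = s≤s (s≤s z≤n)
2↑↑m≤n (suc (suc m)) n@(suc (suc _)) 0<n 2+m≤H =
  let q , q∈ , m<H[val] = find (1+m<H⇒Any[m<H∘val] {n} (s≤s (s≤s z≤n)) 2+m≤H)
      pq = proj₁ (∈-primeDivisors⁻ {n = n} q∈)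
  in begin
    2 ^ (2 ↑↑ suc m)  ≤⟨ ^-monoʳ-≤ 2 (2↑↑m≤n (suc m) (val q n) (∈-primeDivisors⇒0<val 0<n q∈) m<H[val]) ⟩
    2 ^ val q n       ≤⟨ ^-monoˡ-≤ (val q n) (prime⇒1<p pq) ⟩
    q ^ val q n       ≤⟨ p^val≤n pq 0<n ⟩
    n                 ∎
  where open ≤-Reasoning

∣x-y∣≤1 : ∀ {x y} → x ≡ 0ℤ ⊎ x ≡ 1ℤ → y ≡ 0ℤ ⊎ y ≡ 1ℤ → ∣ x - y ∣ ≤ 1
∣x-y∣≤1 (inj₁ refl) (inj₁ refl) = z≤n
∣x-y∣≤1 (inj₁ refl) (inj₂ refl) = ≤-refl
∣x-y∣≤1 (inj₂ refl) (inj₁ refl) = ≤-refl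
∣x-y∣≤1 (inj₂ refl) (inj₂ refl) = z≤n

Δf≢0⇒2↑↑[1+m]≤α : 0 < α → Δ (f m) α ≢ 0ℤ → 2 ↑↑ suc m ≤ α
Δf≢0⇒2↑↑[1+m]≤α {1} _ Δ≢0 = contradiction refl Δ≢0
Δf≢0⇒2↑↑[1+m]≤α {α@(suc β@(suc _))} {m} _ Δ≢0 with ≤-<-connex (H α) m | ≤-<-connex (H β) m
... | inj₂ m<H[α] | _ = 2↑↑m≤n (suc m) α (s≤s z≤n) m<H[α]
... | inj₁ _ | inj₂ m<H[β] = ≤-trans (2↑↑m≤n (suc m) β (s≤s z≤n) m<H[β]) (n≤1+n β)
... | inj₁ H[α]≤m | inj₁ H[β]≤m = contradiction (cong₂ _-_ (f≡1 (s≤s z≤n) H[α]≤m) (f≡1 (s≤s z≤n) H[β]≤m)) Δ≢0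

lemma1 : (m : ℕ) → 1 ≤ m → (F : ℕ → ℤ) → IsDivisorInverse m F →
    (n : ℕ) → 1 ≤ n →
    (F n ≡ prodℤ (map (λ p → f (m ∸ 1) (val p n) - f (m ∸ 1) (val p n ∸ 1)) (primeDivisors n)))
    × (∣ F n ∣ ≤ 1)
    × (F n ≢ 0ℤ → (p α : ℕ) → Prime p → p ∣ n → ExactlyDivides p α n → 2 ↑↑ m ≤ α)
lemma1 (suc m) _ F F-inverse n 0<n = F≡ , ∣F∣≤1 , F≢0⇒
  where
  F≡ : F n ≡ exponentProduct (Δ (f m)) n
  F≡ = divisorSum-injective (λ k 0<k → begin
    divisorSum F k                        ≡⟨ F-inverse k 0<k ⟨
    f (suc m) k                           ≡⟨ f-suc 0<k ⟩
    exponentProduct (f m) k               ≡⟨ divisorSum-exponentProduct-Δ (f m) refl k 0<k ⟨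
    divisorSum (exponentProduct (Δ (f m))) k ∎) n 0<n
    where open ≡-Reasoning
  ∣F∣≤1 : ∣ F n ∣ ≤ 1
  ∣F∣≤1 = subst (λ z → ∣ z ∣ ≤ 1) (sym F≡)
    (∣prodℤ-map∣≤1 (primeDivisors n) ∣Δf[val]∣≤1)
    where
    ∣Δf[val]∣≤1 : ∀ q → ∣ Δ (f m) (val q n) ∣ ≤ 1
    ∣Δf[val]∣≤1 q = ∣x-y∣≤1 (f∈01 m (val q n)) (f∈01 m (val q n ∸ 1))
  F≢0⇒ : F n ≢ 0ℤ → (p α : ℕ) → Prime p → p ∣ n → ExactlyDivides p α n → 2 ↑↑ suc m ≤ α
  F≢0⇒ F≢0 p α pp p∣n p^α∥n = subst (2 ↑↑ suc m ≤_) (sym (exactlyDivides⇒≡val pp 0<n p^α∥n))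
    (Δf≢0⇒2↑↑[1+m]≤α (∣⇒0<val pp 0<n p∣n) λ Δ≡0 →
      F≢0 (trans F≡ (prodℤ-map-≡0 (∈-primeDivisors⁺ 0<n pp p∣n) Δ≡0)))
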